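{- If $G$ is a forest, then $\mathcal{R}(G)$ is connected.
   Context: All graphs are finite, simple and undirected; $N(v)$ denotes the open neighbourhood of $v$. A set $S\subseteq V(G)$ is a dominating set if every vertex of $G$ is in $S$ or adjacent to a vertex of $S$; it is a minimal dominating set if no proper subset of $S$ is a dominating set. The reconfiguration graph $\mathcal{R}(G)$ has as vertex set the collection of all minimal dominating sets of $G$, and two minimal dominating sets $M_1,M_2$ are adjacent iff there is a vertex $v$ with either ($M_2\setminus M_1=\{v\}$ and $M_1\setminus M_2\subseteq N(v)$) or ($M_1\setminus M_2=\{v\}$ and $M_2\setminus M_1\subseteq N(v)$). -}

module Defs where

open import Data.Nat using (ℕ; suc)
open import Data.Bool using (Bool; true; false)
open import Data.Fin using (Fin; zero; suc; inject₁; fromℕ)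
open import Data.Fin.Subset using (Subset; _∈_; _∉_; _⊂_)
open import Data.Product using (Σ; ∃; _×_; _,_)
open import Data.Sum using (_⊎_)
open import Relation.Nullary using (¬_)
open import Relation.Binary.PropositionalEquality using (_≡_)
open import Function.Definitions using (Injective)
open import Relation.Binary.Construct.Closure.ReflexiveTransitive using (Star)

record Graph (n : ℕ) : Set where
  field
    E     : Fin n → Fin n → Bool
    sym   : ∀ u v → E u v ≡ E v u
    irrefl : ∀ v → E v v ≡ false

open Graph public

Adj : ∀ {n} → Graph n → Fin n → Fin n → Set
Adj G u v = E G u v ≡ true

record Cycle {n : ℕ} (G : Graph n) : Set where
  field
    k     : ℕ
    c     : Fin (suc (suc (suc k))) → Fin n
    inj   : Injective _≡_ _≡_ c
    step  : ∀ (i : Fin (suc (suc k))) → Adj G (c (inject₁ i)) (c (suc i))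
    close : Adj G (c (fromℕ (suc (suc k)))) (c zero)

IsForest : ∀ {n} → Graph n → Set
IsForest G = ¬ Cycle G

Dominating : ∀ {n} → Graph n → Subset n → Set
Dominating {n} G S = ∀ (v : Fin n) → v ∈ S ⊎ (∃ λ u → u ∈ S × Adj G u v)

MinDom : ∀ {n} → Graph n → Subset n → Set
MinDom G S = Dominating G S × (∀ T → T ⊂ S → ¬ Dominating G T)

-- One direction of the reconfiguration adjacency:
-- M₂ ∖ M₁ = {v} and M₁ ∖ M₂ ⊆ N(v).
AddSwap : ∀ {n} → Graph n → Subset n → Subset n → Set
AddSwap {n} G M₁ M₂ = ∃ λ (v : Fin n) →
  (∀ x → (x ∈ M₂ × x ∉ M₁) → x ≡ v) × (v ∈ M₂ × v ∉ M₁) ×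
  (∀ x → x ∈ M₁ → x ∉ M₂ → Adj G v x)

REdge : ∀ {n} → Graph n → Subset n → Subset n → Set
REdge G M₁ M₂ = MinDom G M₁ × MinDom G M₂ × (AddSwap G M₁ M₂ ⊎ AddSwap G M₂ M₁)

RConnected : ∀ {n} → Graph n → Set
RConnected G = ∀ M₁ M₂ → MinDom G M₁ → MinDom G M₂ → Star (REdge G) M₁ M₂

module Submission where

open import Defs hiding (sym)
open import Data.Nat using (ℕ; zero; suc; _+_; _<_; s≤s⁻¹)
open import Data.Nat.Properties
  using (+-suc; +-comm; +-assoc; +-identityʳ; <-cmp; n<1+n; m+n≤o⇒n≤o; m≤n⇒∃[o]m+o≡n)
open import Data.Nat.Induction using (<-rec; <-wellFounded)
open import Data.Nat.GeneralisedArithmetic using (fold)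
open import Data.Bool using (true)
import Data.Bool.Properties as Bool
open import Data.Fin using (Fin; toℕ; inject₁; fromℕ)
open import Data.Fin.Properties
  using (toℕ-injective; toℕ<n; toℕ-inject₁; toℕ-fromℕ; pigeonhole; any?; all?; ¬∀⟶∃¬)
  renaming (_≟_ to _≟ᶠ_)
open import Data.Fin.Subset using (Subset; _∈_; _∉_; _⊆_; _⊂_; ∣_∣)
open import Data.Fin.Subset.Properties using (_∈?_; p⊂q⇒∣p∣<∣q∣; ⊆-antisym)
open import Data.Vec using (tabulate)
open import Data.Vec.Properties using (lookup∘tabulate; []=⇒lookup; lookup⇒[]=)
open import Data.Product using (Σ; ∃; _×_; _,_; proj₁; proj₂; uncurry)
open import Data.Sum using (_⊎_; inj₁; inj₂)
open import Data.Empty using (⊥; ⊥-elim)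
open import Function using (_∘_)
open import Function.Definitions using (Injective)
open import Relation.Nullary using (¬_; Dec; yes; no; does)
open import Relation.Nullary.Decidable using (dec-true; decidable-stable; ¬?; _×-dec_; _⊎-dec_; _→-dec_)
open import Relation.Binary.Construct.Closure.ReflexiveTransitive using (Star; ε; _◅_; _◅◅_; reverse)
open import Induction.WellFounded using (Acc; acc)
open import Relation.Unary using (Decidable)
open import Relation.Binary.PropositionalEquality
  using (_≡_; _≢_; refl; sym; trans; cong; subst)
open import Relation.Binary.Definitions using (tri<; tri≈; tri>)

-- A minimal dominating set M is first joined to an independent one: pick u ∈ M with a neighbour
-- in M and exchange u for its external private neighbours, which are pairwise non-adjacent as G
-- has no triangles.  This strictly shrinks the set of vertices of M having a neighbour in M, and
-- keeps M minimal dominating unless it strands some other m ∈ M (every private neighbour of m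
-- becomes adjacent to a new vertex).  Two independent minimal dominating sets A, B are then
-- joined by shrinking A ∖ B one move at a time: add some b ∈ B ∖ A and drop its neighbours in A,
-- or exchange some a ∈ A ∖ B whose external private neighbours all lie in B.  Whenever no move is
-- available, the obstructions chain into an infinite non-backtracking walk, which in a finite
-- graph must close a cycle.

<⇒∃+suc : ∀ {a b} → a < b → ∃ λ e → b ≡ a + suc e
<⇒∃+suc {a} a<b = let e , a+1+e≡b = m≤n⇒∃[o]m+o≡n a<b in e , sym (trans (+-suc a e) a+1+e≡b)

¬→⇒×¬ : ∀ {A B : Set} → Dec A → ¬ (A → B) → A × ¬ B
¬→⇒×¬ (yes a) ¬[A→B] = a , λ b → ¬[A→B] (λ _ → b)
¬→⇒×¬ (no ¬a) ¬[A→B] = ⊥-elim (¬[A→B] (λ a → ⊥-elim (¬a a)))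

∈∉⇒≢ : ∀ {n} {S : Subset n} {x y} → x ∈ S → y ∉ S → x ≢ y
∈∉⇒≢ x∈S y∉S refl = y∉S x∈S

module _ {n : ℕ} {P : Fin n → Set} (P? : Decidable P) where

  select : Subset n
  select = tabulate (does ∘ P?)

  ∈-select⁺ : ∀ {x} → P x → x ∈ select
  ∈-select⁺ {x} p = lookup⇒[]= x select (trans (lookup∘tabulate _ x) (dec-true (P? x) p))

  ∈-select⁻ : ∀ {x} → x ∈ select → P x
  ∈-select⁻ {x} x∈ with P? x | trans (sym (lookup∘tabulate (does ∘ P?) x)) ([]=⇒lookup x∈)
  ... | yes p | _ = p
  ... | no _  | ()

module _ {n : ℕ} where

  ∈-∖? : (A B : Subset n) → Decidable (λ x → x ∈ A × x ∉ B)
  ∈-∖? A B x = (x ∈? A) ×-dec ¬? (x ∈? B)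

  _∖_ : Subset n → Subset n → Subset n
  A ∖ B = select (∈-∖? A B)

  ∄∖⇒⊆ : ∀ {A B : Subset n} → ¬ (∃ λ x → x ∈ A × x ∉ B) → A ⊆ B
  ∄∖⇒⊆ {B = B} none {x} x∈A with x ∈? B
  ... | yes x∈B = x∈B
  ... | no x∉B  = ⊥-elim (none (x , x∈A , x∉B))

  ∖-⊂ : ∀ {A B X : Subset n} {a} → (∀ {x} → x ∈ X → x ∉ B → x ∈ A) → a ∈ A → a ∉ B → a ∉ X →
        X ∖ B ⊂ A ∖ B
  ∖-⊂ {A} {B} {X} X⊆A∪B a∈A a∉B a∉X =
    (λ x∈ → let x∈X , x∉B = ∈-select⁻ (∈-∖? X B) x∈ in ∈-select⁺ (∈-∖? A B) (X⊆A∪B x∈X x∉B , x∉B)) ,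
    _ , ∈-select⁺ (∈-∖? A B) (a∈A , a∉B) , (λ a∈ → a∉X (proj₁ (∈-select⁻ (∈-∖? X B) a∈)))

module Adjacency {n : ℕ} (G : Graph n) where

  Adj? : ∀ x y → Dec (Adj G x y)
  Adj? x y = E G x y Bool.≟ true

  Adj-sym : ∀ {x y} → Adj G x y → Adj G y x
  Adj-sym {x} {y} = trans (Graph.sym G y x)

  Adj-irrefl : ∀ {x} → ¬ Adj G x x
  Adj-irrefl {x} a with trans (sym a) (irrefl G x)
  ... | ()

  Adj⇒≢ : ∀ {x y} → Adj G x y → x ≢ y
  Adj⇒≢ a refl = Adj-irrefl a

  closedWalk⇒cycle : (v : ℕ → Fin n) (k : ℕ) → (∀ m → Adj G (v m) (v (suc m))) →
                     (∀ a b → a < b → b < 3 + k → v a ≢ v b) → v (3 + k) ≡ v 0 → Cycle G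
  closedWalk⇒cycle v k step distinct closes =
    record { k = k ; c = v ∘ toℕ ; inj = injective ; step = step′ ; close = close′ }
    where
    injective : Injective _≡_ _≡_ (v ∘ toℕ)
    injective {i} {j} eq with <-cmp (toℕ i) (toℕ j)
    ... | tri< i<j _ _ = ⊥-elim (distinct _ _ i<j (toℕ<n j) eq)
    ... | tri≈ _ i≡j _ = toℕ-injective i≡j
    ... | tri> _ _ j<i = ⊥-elim (distinct _ _ j<i (toℕ<n i) (sym eq))
    step′ : ∀ i → Adj G (v (toℕ (inject₁ i))) (v (suc (toℕ i)))
    step′ i rewrite toℕ-inject₁ i = step (toℕ i)
    close′ : Adj G (v (toℕ (fromℕ (2 + k)))) (v 0)
    close′ rewrite toℕ-fromℕ (2 + k) = subst (Adj G (v (2 + k))) closes (step (2 + k))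

module Domination {n : ℕ} (G : Graph n) where
  open Adjacency G public

  infix 4 _∈N[_] _∈N[_]?

  _∈N[_] : Fin n → Fin n → Set
  w ∈N[ u ] = w ≡ u ⊎ Adj G u w

  _∈N[_]? : ∀ w u → Dec (w ∈N[ u ])
  w ∈N[ u ]? = (w ≟ᶠ u) ⊎-dec Adj? u w

  DominatedBy : Subset n → Fin n → Set
  DominatedBy S v = v ∈ S ⊎ ∃ λ u → u ∈ S × Adj G u v

  dominatedBy? : ∀ S v → Dec (DominatedBy S v)
  dominatedBy? S v = (v ∈? S) ⊎-dec any? (λ u → (u ∈? S) ×-dec Adj? u v)

  dominating? : ∀ S → Dec (Dominating G S)
  dominating? S = all? (dominatedBy? S)

  ∈N⇒dominatedBy : ∀ {S u w} → u ∈ S → w ∈N[ u ] → DominatedBy S w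
  ∈N⇒dominatedBy u∈S (inj₁ refl) = inj₁ u∈S
  ∈N⇒dominatedBy u∈S (inj₂ a)    = inj₂ (_ , u∈S , a)

  dominatedBy⇒∈N : ∀ {S w} → DominatedBy S w → ∃ λ u → u ∈ S × w ∈N[ u ]
  dominatedBy⇒∈N (inj₁ w∈S)           = _ , w∈S , inj₁ refl
  dominatedBy⇒∈N (inj₂ (u , u∈S , a)) = u , u∈S , inj₂ a

  Independent : Subset n → Set
  Independent S = ∀ x y → x ∈ S → y ∈ S → ¬ Adj G x y

  Private : Subset n → Fin n → Fin n → Set
  Private S u w = w ∈N[ u ] × (∀ u′ → u′ ∈ S → w ∈N[ u′ ] → u′ ≡ u)

  private? : ∀ S u w → Dec (Private S u w)
  private? S u w = (w ∈N[ u ]?) ×-dec all? (λ u′ → (u′ ∈? S) →-dec ((w ∈N[ u′ ]?) →-dec (u′ ≟ᶠ u)))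

  ExternalPrivate : Subset n → Fin n → Fin n → Set
  ExternalPrivate S u w = Private S u w × w ≢ u

  externalPrivate? : ∀ S u w → Dec (ExternalPrivate S u w)
  externalPrivate? S u w = private? S u w ×-dec ¬? (w ≟ᶠ u)

  externalPrivate-adj : ∀ {S u w} → ExternalPrivate S u w → Adj G u w
  externalPrivate-adj ((inj₁ w≡u , _) , w≢u) = ⊥-elim (w≢u w≡u)
  externalPrivate-adj ((inj₂ a , _) , _)     = a

  externalPrivate-∉ : ∀ {S u w} → ExternalPrivate S u w → w ∉ S
  externalPrivate-∉ ((_ , unique) , w≢u) w∈S = w≢u (unique _ w∈S (inj₁ refl))

  private-dominatedBy⇒∈ : ∀ {S T u w} → T ⊆ S → Private S u w → DominatedBy T w → u ∈ T
  private-dominatedBy⇒∈ T⊆S (_ , unique) T-dom with dominatedBy⇒∈N T-dom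
  ... | u′ , u′∈T , w∈N[u′] = subst (_∈ _) (unique u′ (T⊆S u′∈T) w∈N[u′]) u′∈T

  private⇒minimal : ∀ {S} → Dominating G S → (∀ u → u ∈ S → ∃ (Private S u)) → MinDom G S
  private⇒minimal dom priv = dom , λ where
    T (T⊆S , u , u∈S , u∉T) T-dom →
      let w , w-private = priv u u∈S in u∉T (private-dominatedBy⇒∈ T⊆S w-private (T-dom w))

  minimal⇒private : ∀ {S} → MinDom G S → ∀ u → u ∈ S → ∃ (Private S u)
  minimal⇒private {S} (dom , minimal) u u∈S =
    let u′ , u′∈S , w∈N[u′] = dominatedBy⇒∈N (dom w)
    in w , subst (w ∈N[_]) (unique u′ u′∈S w∈N[u′]) w∈N[u′] , unique
    where
    other? : Decidable (λ x → x ∈ S × x ≢ u)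
    other? x = (x ∈? S) ×-dec ¬? (x ≟ᶠ u)
    T : Subset n
    T = select other?
    T⊂S : T ⊂ S
    T⊂S = (λ x∈T → proj₁ (∈-select⁻ other? x∈T)) , u , u∈S , (λ u∈T → proj₂ (∈-select⁻ other? u∈T) refl)
    undominated : ∃ λ w → ¬ DominatedBy T w
    undominated = ¬∀⟶∃¬ n (DominatedBy T) (dominatedBy? T) (minimal T T⊂S)
    w : Fin n
    w = proj₁ undominated
    unique : ∀ u′ → u′ ∈ S → w ∈N[ u′ ] → u′ ≡ u
    unique u′ u′∈S w∈N[u′] with u′ ≟ᶠ u
    ... | yes u′≡u = u′≡u
    ... | no u′≢u  = ⊥-elim (proj₂ undominated (∈N⇒dominatedBy (∈-select⁺ other? (u′∈S , u′≢u)) w∈N[u′]))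

  independent⇒minimal : ∀ {S} → Independent S → Dominating G S → MinDom G S
  independent⇒minimal independent dom = private⇒minimal dom λ u u∈S → u , inj₁ refl , λ where
    u′ u′∈S (inj₁ u≡u′) → sym u≡u′
    u′ u′∈S (inj₂ a)    → ⊥-elim (independent u′ u u′∈S u∈S a)

  ⊆-minimal⇒≡ : ∀ {A B} → MinDom G A → Dominating G B → B ⊆ A → B ≡ A
  ⊆-minimal⇒≡ (_ , minimal) B-dom B⊆A =
    ⊆-antisym B⊆A (∄∖⇒⊆ λ (x , x∈A , x∉B) → minimal _ (B⊆A , x , x∈A , x∉B) B-dom)

  REdge-sym : ∀ {M₁ M₂} → REdge G M₁ M₂ → REdge G M₂ M₁
  REdge-sym (m₁ , m₂ , inj₁ swap) = m₂ , m₁ , inj₂ swap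
  REdge-sym (m₁ , m₂ , inj₂ swap) = m₂ , m₁ , inj₁ swap

  Exchanged : Subset n → Fin n → Fin n → Set
  Exchanged M u x = (x ∈ M × x ≢ u) ⊎ ExternalPrivate M u x

  exchanged? : ∀ M u → Decidable (Exchanged M u)
  exchanged? M u x = ((x ∈? M) ×-dec ¬? (x ≟ᶠ u)) ⊎-dec externalPrivate? M u x

  exchange : Subset n → Fin n → Subset n
  exchange M u = select (exchanged? M u)

  ∉-exchange : ∀ M u → u ∉ exchange M u
  ∉-exchange M u u∈X with ∈-select⁻ (exchanged? M u) u∈X
  ... | inj₁ (_ , u≢u) = u≢u refl
  ... | inj₂ (_ , u≢u) = u≢u refl

  exchange-swap : ∀ {M u} → u ∈ M → AddSwap G (exchange M u) M
  exchange-swap {M} {u} u∈M = u , removedOnly , (u∈M , ∉-exchange M u) , addedAdjacent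
    where
    removedOnly : ∀ x → x ∈ M × x ∉ exchange M u → x ≡ u
    removedOnly x (x∈M , x∉X) with x ≟ᶠ u
    ... | yes x≡u = x≡u
    ... | no x≢u  = ⊥-elim (x∉X (∈-select⁺ (exchanged? M u) (inj₁ (x∈M , x≢u))))
    addedAdjacent : ∀ x → x ∈ exchange M u → x ∉ M → Adj G u x
    addedAdjacent x x∈X x∉M with ∈-select⁻ (exchanged? M u) x∈X
    ... | inj₁ (x∈M , _) = ⊥-elim (x∉M x∈M)
    ... | inj₂ external  = externalPrivate-adj external

  exchange-dominating : ∀ {M u} → Dominating G M → DominatedBy (exchange M u) u →
                        Dominating G (exchange M u)
  exchange-dominating {M} {u} dom u-dom v with v ≟ᶠ u
  ... | yes refl = u-dom
  ... | no v≢u with any? (λ u′ → ((u′ ∈? M) ×-dec ¬? (u′ ≟ᶠ u)) ×-dec (v ∈N[ u′ ]?))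
  ...   | yes (u′ , u′-kept , v∈N[u′]) = ∈N⇒dominatedBy (∈-select⁺ (exchanged? M u) (inj₁ u′-kept)) v∈N[u′]
  ...   | no none = inj₁ (∈-select⁺ (exchanged? M u) (inj₂ ((v∈N[u] , unique) , v≢u)))
    where
    unique : ∀ u′ → u′ ∈ M → v ∈N[ u′ ] → u′ ≡ u
    unique u′ u′∈M v∈N[u′] with u′ ≟ᶠ u
    ... | yes u′≡u = u′≡u
    ... | no u′≢u  = ⊥-elim (none (u′ , (u′∈M , u′≢u) , v∈N[u′]))
    v∈N[u] : v ∈N[ u ]
    v∈N[u] = let u′ , u′∈M , v∈N[u′] = dominatedBy⇒∈N (dom v)
             in subst (v ∈N[_]) (unique u′ u′∈M v∈N[u′]) v∈N[u′]

  Stolen : Subset n → Fin n → Fin n → Set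
  Stolen M u w = ∃ λ p → ExternalPrivate M u p × Adj G p w

  stolen? : ∀ M u w → Dec (Stolen M u w)
  stolen? M u w = any? λ p → externalPrivate? M u p ×-dec Adj? p w

  stolen-∈⇒≡ : ∀ {M u w} → Stolen M u w → w ∈ M → w ≡ u
  stolen-∈⇒≡ (p , ((_ , unique) , _) , pw) w∈M = unique _ w∈M (inj₂ (Adj-sym pw))

  exchange-private-kept : ∀ {M u x w} → x ∈ M → x ≢ u → Private M x w → ¬ Stolen M u w →
                          Private (exchange M u) x w
  exchange-private-kept {M} {u} {x} {w} x∈M x≢u (w∈N[x] , unique) untouched = w∈N[x] , unique′
    where
    unique′ : ∀ y → y ∈ exchange M u → w ∈N[ y ] → y ≡ x
    unique′ y y∈X w∈N[y] with ∈-select⁻ (exchanged? M u) y∈X | w∈N[y]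
    ... | inj₁ (y∈M , _) | _        = unique y y∈M w∈N[y]
    ... | inj₂ y-ext     | inj₁ refl = ⊥-elim (x≢u (proj₂ (proj₁ y-ext) x x∈M w∈N[x]))
    ... | inj₂ y-ext     | inj₂ yw   = ⊥-elim (untouched (y , y-ext , yw))

  Absorbed : Subset n → Fin n → Fin n → Set
  Absorbed A b x = x ≡ b ⊎ (x ∈ A × ¬ Adj G b x)

  absorbed? : ∀ A b → Decidable (Absorbed A b)
  absorbed? A b x = (x ≟ᶠ b) ⊎-dec ((x ∈? A) ×-dec ¬? (Adj? b x))

  absorb : Subset n → Fin n → Subset n
  absorb A b = select (absorbed? A b)

  absorb-independent : ∀ {A b} → Independent A → Independent (absorb A b)
  absorb-independent {A} {b} A-ind x y x∈X y∈X xy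
    with ∈-select⁻ (absorbed? A b) x∈X | ∈-select⁻ (absorbed? A b) y∈X
  ... | inj₁ refl        | inj₁ refl        = Adj-irrefl xy
  ... | inj₁ refl        | inj₂ (_ , ¬by)   = ¬by xy
  ... | inj₂ (_ , ¬bx)   | inj₁ refl        = ¬bx (Adj-sym xy)
  ... | inj₂ (x∈A , _)   | inj₂ (y∈A , _)   = A-ind x y x∈A y∈A xy

  absorb-swap : ∀ {A b} → b ∉ A → AddSwap G A (absorb A b)
  absorb-swap {A} {b} b∉A = b , addedOnly , (∈-select⁺ (absorbed? A b) (inj₁ refl) , b∉A) , removedAdjacent
    where
    addedOnly : ∀ x → x ∈ absorb A b × x ∉ A → x ≡ b
    addedOnly x (x∈X , x∉A) with ∈-select⁻ (absorbed? A b) x∈X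
    ... | inj₁ x≡b       = x≡b
    ... | inj₂ (x∈A , _) = ⊥-elim (x∉A x∈A)
    removedAdjacent : ∀ x → x ∈ A → x ∉ absorb A b → Adj G b x
    removedAdjacent x x∈A x∉X with Adj? b x
    ... | yes bx = bx
    ... | no ¬bx = ⊥-elim (x∉X (∈-select⁺ (absorbed? A b) (inj₂ (x∈A , ¬bx))))

  absorb-∖⊂ : ∀ {A B b} → Dominating G A → Independent B → b ∈ B → b ∉ A → absorb A b ∖ B ⊂ A ∖ B
  absorb-∖⊂ {A} {B} {b} A-dom B-ind b∈B b∉A with A-dom b
  ... | inj₁ b∈A = ⊥-elim (b∉A b∈A)
  ... | inj₂ (a , a∈A , ab) = ∖-⊂ keptFromA a∈A (λ a∈B → B-ind a b a∈B b∈B ab) a∉X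
    where
    keptFromA : ∀ {x} → x ∈ absorb A b → x ∉ B → x ∈ A
    keptFromA x∈X x∉B with ∈-select⁻ (absorbed? A b) x∈X
    ... | inj₁ refl      = ⊥-elim (x∉B b∈B)
    ... | inj₂ (x∈A , _) = x∈A
    a∉X : a ∉ absorb A b
    a∉X a∈X with ∈-select⁻ (absorbed? A b) a∈X
    ... | inj₁ refl     = b∉A a∈A
    ... | inj₂ (_ , ¬ba) = ¬ba (Adj-sym ab)

module Forest {n : ℕ} (G : Graph n) (forest : IsForest G) where
  open Domination G

  noNonBacktrackingRay : (w : ℕ → Fin n) → (∀ i → Adj G (w i) (w (suc i))) →
                         (∀ i → w (2 + i) ≢ w i) → ⊥
  noNonBacktrackingRay w step nonBacktracking =
    let i , _ , i<j , wi≡wj = pigeonhole (n<1+n n) (w ∘ toℕ)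
        d , j≡i+1+d = <⇒∃+suc i<j
    in noReturn d (toℕ i) (trans wi≡wj (cong w j≡i+1+d))
    where
    -- A first return after at least three steps traces a cycle.
    noReturnWithin : ∀ d → (∀ {e} → e < d → ∀ i → w i ≢ w (i + suc e)) → ∀ i → w i ≢ w (i + suc d)
    noReturnWithin zero _ i eq = Adj⇒≢ (step i) (trans eq (cong w (+-comm i 1)))
    noReturnWithin (suc zero) _ i eq = nonBacktracking i (sym (trans eq (cong w (+-comm i 2))))
    noReturnWithin (suc (suc k)) shorter i eq =
      forest (closedWalk⇒cycle (w ∘ (i +_)) k segmentStep segmentDistinct closes)
      where
      segmentStep : ∀ m → Adj G (w (i + m)) (w (i + suc m))
      segmentStep m = subst (Adj G (w (i + m))) (cong w (sym (+-suc i m))) (step (i + m))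
      segmentDistinct : ∀ a b → a < b → b < 3 + k → w (i + a) ≢ w (i + b)
      segmentDistinct a b a<b b<3+k =
        let e , b≡a+1+e = <⇒∃+suc a<b
        in λ eq′ → shorter (m+n≤o⇒n≤o a (s≤s⁻¹ (subst (_< 3 + k) b≡a+1+e b<3+k))) (i + a)
                     (trans eq′ (cong w (trans (cong (i +_) b≡a+1+e) (sym (+-assoc i a (suc e))))))
      closes : w (i + (3 + k)) ≡ w (i + 0)
      closes = sym (trans (cong w (+-identityʳ i)) eq)

    noReturn : ∀ d i → w i ≢ w (i + suc d)
    noReturn = <-rec _ noReturnWithin

  noExtendableArcs : (Q : Fin n → Fin n → Set) → (∀ {x y} → Q x y → Adj G x y) →
                     (∀ {x y} → Q x y → ∃ λ z → z ≢ x × Q y z) → ∀ {x y} → ¬ Q x y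
  noExtendableArcs Q arc extend {x} {y} q =
    noNonBacktrackingRay (tail ∘ ray) (λ i → arc (proj₂ (ray i)))
      (λ i → proj₁ (proj₂ (extend (proj₂ (ray i)))))
    where
    Arc : Set
    Arc = Σ (Fin n × Fin n) (uncurry Q)
    tail : Arc → Fin n
    tail ((x , _) , _) = x
    next : Arc → Arc
    next ((_ , y) , q) = let z , _ , q′ = extend q in (y , z) , q′
    ray : ℕ → Arc
    ray = fold ((x , y) , q) next

  noTriangle : ∀ {x y z} → Adj G x y → Adj G y z → Adj G z x → ⊥
  noTriangle {x} {y} {z} xy yz zx = noExtendableArcs Triangle arc extend (inj₁ (refl , refl))
    where
    Triangle : Fin n → Fin n → Set
    Triangle a b = (a ≡ x × b ≡ y) ⊎ (a ≡ y × b ≡ z) ⊎ (a ≡ z × b ≡ x)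
    arc : ∀ {a b} → Triangle a b → Adj G a b
    arc (inj₁ (refl , refl))        = xy
    arc (inj₂ (inj₁ (refl , refl))) = yz
    arc (inj₂ (inj₂ (refl , refl))) = zx
    extend : ∀ {a b} → Triangle a b → ∃ λ c → c ≢ a × Triangle b c
    extend (inj₁ (refl , refl))        = z , Adj⇒≢ zx , inj₂ (inj₁ (refl , refl))
    extend (inj₂ (inj₁ (refl , refl))) = x , Adj⇒≢ xy , inj₂ (inj₂ (refl , refl))
    extend (inj₂ (inj₂ (refl , refl))) = y , Adj⇒≢ yz , inj₁ (refl , refl)

  noFourCycle : ∀ {p q r s} → Adj G p q → Adj G q r → Adj G r s → Adj G s p → p ≢ r → q ≢ s → ⊥
  noFourCycle {p} {q} {r} {s} pq qr rs sp p≢r q≢s =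
    noExtendableArcs Square arc extend (inj₁ (refl , refl))
    where
    Square : Fin n → Fin n → Set
    Square a b = (a ≡ p × b ≡ q) ⊎ (a ≡ q × b ≡ r) ⊎ (a ≡ r × b ≡ s) ⊎ (a ≡ s × b ≡ p)
    arc : ∀ {a b} → Square a b → Adj G a b
    arc (inj₁ (refl , refl))               = pq
    arc (inj₂ (inj₁ (refl , refl)))        = qr
    arc (inj₂ (inj₂ (inj₁ (refl , refl)))) = rs
    arc (inj₂ (inj₂ (inj₂ (refl , refl)))) = sp
    extend : ∀ {a b} → Square a b → ∃ λ c → c ≢ a × Square b c
    extend (inj₁ (refl , refl))               = r , p≢r ∘ sym , inj₂ (inj₁ (refl , refl))
    extend (inj₂ (inj₁ (refl , refl)))        = s , q≢s ∘ sym , inj₂ (inj₂ (inj₁ (refl , refl)))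
    extend (inj₂ (inj₂ (inj₁ (refl , refl)))) = p , p≢r , inj₂ (inj₂ (inj₂ (refl , refl)))
    extend (inj₂ (inj₂ (inj₂ (refl , refl)))) = q , q≢s , inj₁ (refl , refl)

  exchange-adjacent⇒∈ : ∀ {M u x y} → x ∈ exchange M u → y ∈ exchange M u → Adj G x y → x ∈ M × y ∈ M
  exchange-adjacent⇒∈ {M} {u} x∈X y∈X xy
    with ∈-select⁻ (exchanged? M u) x∈X | ∈-select⁻ (exchanged? M u) y∈X
  ... | inj₁ (x∈M , _)   | inj₁ (y∈M , _)   = x∈M , y∈M
  ... | inj₁ (x∈M , x≢u) | inj₂ y-ext       = ⊥-elim (x≢u (proj₂ (proj₁ y-ext) _ x∈M (inj₂ xy)))
  ... | inj₂ x-ext       | inj₁ (y∈M , y≢u) = ⊥-elim (y≢u (proj₂ (proj₁ x-ext) _ y∈M (inj₂ (Adj-sym xy))))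
  ... | inj₂ x-ext       | inj₂ y-ext       =
    ⊥-elim (noTriangle (externalPrivate-adj x-ext) xy (Adj-sym (externalPrivate-adj y-ext)))

  exchange-private : ∀ {M u x} → ExternalPrivate M u x → Private (exchange M u) x x
  exchange-private {M} {u} {x} x-ext = inj₁ refl , unique
    where
    unique : ∀ y → y ∈ exchange M u → x ∈N[ y ] → y ≡ x
    unique y y∈X x∈N[y] with ∈-select⁻ (exchanged? M u) y∈X | x∈N[y]
    ... | inj₁ (y∈M , y≢u) | _        = ⊥-elim (y≢u (proj₂ (proj₁ x-ext) y y∈M x∈N[y]))
    ... | inj₂ _           | inj₁ x≡y = sym x≡y
    ... | inj₂ y-ext       | inj₂ yx  =
      ⊥-elim (noTriangle (externalPrivate-adj y-ext) yx (Adj-sym (externalPrivate-adj x-ext)))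

  exchange-independent : ∀ {A a} → Independent A → Independent (exchange A a)
  exchange-independent A-ind x y x∈X y∈X xy =
    let x∈A , y∈A = exchange-adjacent⇒∈ x∈X y∈X xy in A-ind x y x∈A y∈A xy

module ToIndependent {n : ℕ} (G : Graph n) (forest : IsForest G) where
  open Domination G
  open Forest G forest

  NonIsolated : Subset n → Fin n → Set
  NonIsolated M x = x ∈ M × ∃ λ y → y ∈ M × Adj G x y

  nonIsolated? : ∀ M → Decidable (NonIsolated M)
  nonIsolated? M x = (x ∈? M) ×-dec any? (λ y → (y ∈? M) ×-dec Adj? x y)

  nonIsolated : Subset n → Subset n
  nonIsolated M = select (nonIsolated? M)

  -- Exchanging u would leave m with no private neighbour.
  Stranded : Subset n → Fin n → Fin n → Set
  Stranded M u m = ∀ w → Private M m w → Stolen M u w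

  stranded? : ∀ M u m → Dec (Stranded M u m)
  stranded? M u m = all? λ w → private? M m w →-dec stolen? M u w

  Blocked : Subset n → Fin n → Set
  Blocked M u = ∃ λ m → m ∈ M × m ≢ u × Stranded M u m

  blocked? : ∀ M u → Dec (Blocked M u)
  blocked? M u = any? λ m → (m ∈? M) ×-dec ¬? (m ≟ᶠ u) ×-dec stranded? M u m

  exchange-minimal : ∀ {M u} → MinDom G M → NonIsolated M u → ¬ Blocked M u → MinDom G (exchange M u)
  exchange-minimal {M} {u} (dom , _) (u∈M , v , v∈M , uv) unblocked =
    private⇒minimal (exchange-dominating dom (inj₂ (v , v∈X , Adj-sym uv))) privateOf
    where
    v∈X : v ∈ exchange M u
    v∈X = ∈-select⁺ (exchanged? M u) (inj₁ (v∈M , Adj⇒≢ uv ∘ sym))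
    privateOf : ∀ x → x ∈ exchange M u → ∃ (Private (exchange M u) x)
    privateOf x x∈X with ∈-select⁻ (exchanged? M u) x∈X
    ... | inj₂ x-ext = x , exchange-private x-ext
    ... | inj₁ (x∈M , x≢u) =
      let w , ¬stranded = ¬∀⟶∃¬ n _ (λ w → private? M x w →-dec stolen? M u w)
                                  λ stranded → unblocked (x , x∈M , x≢u , stranded)
          w-private , untouched = ¬→⇒×¬ (private? M x w) ¬stranded
      in w , exchange-private-kept x∈M x≢u w-private untouched

  exchange-nonIsolated⊂ : ∀ {M u} → NonIsolated M u → nonIsolated (exchange M u) ⊂ nonIsolated M
  exchange-nonIsolated⊂ {M} {u} u-ni = kept , u , ∈-select⁺ (nonIsolated? M) u-ni , u-lost
    where
    kept : nonIsolated (exchange M u) ⊆ nonIsolated M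
    kept x∈ with ∈-select⁻ (nonIsolated? (exchange M u)) x∈
    ... | x∈X , y , y∈X , xy =
      let x∈M , y∈M = exchange-adjacent⇒∈ x∈X y∈X xy in ∈-select⁺ (nonIsolated? M) (x∈M , y , y∈M , xy)
    u-lost : u ∉ nonIsolated (exchange M u)
    u-lost u∈ = ∉-exchange M u (proj₁ (∈-select⁻ (nonIsolated? (exchange M u)) u∈))

  stranded⇒nonIsolated : ∀ {M u m} → m ∈ M → m ≢ u → Stranded M u m → NonIsolated M m
  stranded⇒nonIsolated {M} {m = m} m∈M m≢u stranded with any? (λ m′ → (m′ ∈? M) ×-dec Adj? m m′)
  ... | yes m-has-neighbour = m∈M , m-has-neighbour
  ... | no isolated = ⊥-elim (m≢u (stolen-∈⇒≡ (stranded m (inj₁ refl , unique)) m∈M))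
    where
    unique : ∀ u′ → u′ ∈ M → m ∈N[ u′ ] → u′ ≡ m
    unique u′ _    (inj₁ m≡u′) = sym m≡u′
    unique u′ u′∈M (inj₂ u′m)  = ⊥-elim (isolated (u′ , u′∈M , Adj-sym u′m))

  blocked⇒detour : ∀ {M y} → MinDom G M → Blocked M y →
                   ∃ λ p → ExternalPrivate M y p × ∃ λ q → q ∉ M × Adj G p q ×
                   ∃ λ m → Adj G q m × NonIsolated M m
  blocked⇒detour {M} md (m , m∈M , m≢y , stranded) =
    let q , q-private = minimal⇒private md m m∈M
        p , p-ext , pq = stranded q q-private
        q-ext : ExternalPrivate M m q
        q-ext = q-private , λ q≡m → m≢y (stolen-∈⇒≡ (p , p-ext , subst (Adj G p) q≡m pq) m∈M)
    in p , p-ext , q , externalPrivate-∉ q-ext , pq , m , Adj-sym (externalPrivate-adj q-ext) ,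
       stranded⇒nonIsolated m∈M m≢y stranded

  module BlockedWalk (M : Subset n) (md : MinDom G M)
                     (allBlocked : ∀ {u} → NonIsolated M u → Blocked M u) where

    -- Membership in M follows the pattern ∈ ∈ ∉ ∉ ∈ ∈ …, so every two steps change it and the
    -- walk never backtracks.
    data Arc (x y : Fin n) : Set where
      inside   : x ∈ M → y ∈ M → Arc x y
      leaving  : x ∈ M → y ∉ M → ∀ q → q ∉ M → Adj G y q → ∀ m → Adj G q m → NonIsolated M m → Arc x y
      outside  : x ∉ M → y ∉ M → ∀ m → Adj G y m → NonIsolated M m → Arc x y
      entering : x ∉ M → NonIsolated M y → Arc x y

    extend : ∀ {x y} → Adj G x y × Arc x y → ∃ λ z → z ≢ x × Adj G y z × Arc y z
    extend (xy , inside x∈M y∈M) =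
      let p , p-ext , q , q∉M , pq , m , qm , m-ni =
            blocked⇒detour md (allBlocked (y∈M , _ , x∈M , Adj-sym xy))
          p∉M = externalPrivate-∉ p-ext
      in p , ∈∉⇒≢ x∈M p∉M ∘ sym , externalPrivate-adj p-ext , leaving y∈M p∉M q q∉M pq m qm m-ni
    extend (_ , leaving x∈M y∉M q q∉M yq m qm m-ni) =
      q , ∈∉⇒≢ x∈M q∉M ∘ sym , yq , outside y∉M q∉M m qm m-ni
    extend (_ , outside x∉M y∉M m ym m-ni) =
      m , ∈∉⇒≢ (proj₁ m-ni) x∉M , ym , entering y∉M m-ni
    extend (_ , entering x∉M (y∈M , m′ , m′∈M , ym′)) =
      m′ , ∈∉⇒≢ m′∈M x∉M , ym′ , inside y∈M m′∈M

    impossible : ∀ {u} → ¬ NonIsolated M u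
    impossible (u∈M , v , v∈M , uv) =
      noExtendableArcs (λ x y → Adj G x y × Arc x y) proj₁ extend (uv , inside u∈M v∈M)

  someUnblocked : ∀ {M u₀} → MinDom G M → NonIsolated M u₀ → ∃ λ u → NonIsolated M u × ¬ Blocked M u
  someUnblocked {M} md u₀-ni with any? (λ u → nonIsolated? M u ×-dec ¬? (blocked? M u))
  ... | yes found = found
  ... | no none = ⊥-elim (BlockedWalk.impossible M md allBlocked u₀-ni)
    where
    allBlocked : ∀ {u} → NonIsolated M u → Blocked M u
    allBlocked {u} u-ni = decidable-stable (blocked? M u) λ unblocked → none (u , u-ni , unblocked)

  exchangeStep : ∀ {M u₀} → MinDom G M → NonIsolated M u₀ →
                 ∃ λ X → REdge G M X × nonIsolated X ⊂ nonIsolated M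
  exchangeStep {M} md u₀-ni =
    let u , u-ni , unblocked = someUnblocked md u₀-ni
    in exchange M u ,
       (md , exchange-minimal md u-ni unblocked , inj₂ (exchange-swap (proj₁ u-ni))) ,
       exchange-nonIsolated⊂ u-ni

  reachIndependent : ∀ M → Acc _<_ ∣ nonIsolated M ∣ → MinDom G M →
                     ∃ λ I → Independent I × MinDom G I × Star (REdge G) M I
  reachIndependent M (acc smaller) md with any? (nonIsolated? M)
  ... | no none = M , (λ x y x∈M y∈M xy → none (x , x∈M , y , y∈M , xy)) , md , ε
  ... | yes (_ , u₀-ni) =
    let X , M—X , shrinks = exchangeStep md u₀-ni
        I , independent , mdI , X⋯I = reachIndependent X (smaller (p⊂q⇒∣p∣<∣q∣ shrinks)) (proj₁ (proj₂ M—X))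
    in I , independent , mdI , M—X ◅ X⋯I

module BetweenIndependent {n : ℕ} (G : Graph n) (forest : IsForest G) where
  open Domination G
  open Forest G forest

  Removable : Subset n → Subset n → Fin n → Set
  Removable A B a = ∃ (ExternalPrivate A a) × (∀ y → ExternalPrivate A a y → y ∈ B)

  removable? : ∀ A B a → Dec (Removable A B a)
  removable? A B a = any? (externalPrivate? A a) ×-dec all? (λ y → externalPrivate? A a y →-dec (y ∈? B))

  nonRemovable : ∀ {A B a} → ¬ Removable A B a → ∃ (ExternalPrivate A a) →
                 ∃ λ y → ExternalPrivate A a y × y ∉ B
  nonRemovable {A} {B} {a} ¬removable a-has =
    let y , notInB = ¬∀⟶∃¬ n _ (λ y → externalPrivate? A a y →-dec (y ∈? B)) (¬removable ∘ (a-has ,_))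
    in y , ¬→⇒×¬ (externalPrivate? A a y) notInB

  absorb-undominated : ∀ {A B b z} → Dominating G A → Independent B → b ∈ B → b ∉ A →
                       ¬ DominatedBy (absorb A b) z →
                       ∃ λ a → Adj G b a × a ∈ A × a ∉ B × ∃ (ExternalPrivate A a)
  absorb-undominated {A} {b = b} {z} A-dom B-ind b∈B b∉A undominated =
    let a , a∈A , az = dominator
        ba = neighbourOfB a∈A az
    in a , ba , a∈A , (λ a∈B → B-ind b a b∈B a∈B ba) , z , z-external a∈A az
    where
    b∈X : b ∈ absorb A b
    b∈X = ∈-select⁺ (absorbed? A b) (inj₁ refl)
    neighbourOfB : ∀ {a} → a ∈ A → Adj G a z → Adj G b a
    neighbourOfB {a} a∈A az with Adj? b a
    ... | yes ba = ba
    ... | no ¬ba = ⊥-elim (undominated (inj₂ (a , ∈-select⁺ (absorbed? A b) (inj₂ (a∈A , ¬ba)) , az)))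
    z∉A : z ∉ A
    z∉A z∈A with Adj? b z
    ... | yes bz = undominated (inj₂ (b , b∈X , bz))
    ... | no ¬bz = undominated (inj₁ (∈-select⁺ (absorbed? A b) (inj₂ (z∈A , ¬bz))))
    z≢b : z ≢ b
    z≢b refl = undominated (inj₁ b∈X)
    dominator : ∃ λ a → a ∈ A × Adj G a z
    dominator with A-dom z
    ... | inj₁ z∈A = ⊥-elim (z∉A z∈A)
    ... | inj₂ d   = d
    sameNeighbour : ∀ {a a′} → a ∈ A → a′ ∈ A → Adj G a z → Adj G a′ z → a′ ≡ a
    sameNeighbour {a} {a′} a∈A a′∈A az a′z with a′ ≟ᶠ a
    ... | yes a′≡a = a′≡a
    ... | no a′≢a  = ⊥-elim (noFourCycle az (Adj-sym a′z) (Adj-sym (neighbourOfB a′∈A a′z))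
                                         (neighbourOfB a∈A az) (a′≢a ∘ sym) z≢b)
    z-external : ∀ {a} → a ∈ A → Adj G a z → ExternalPrivate A a z
    z-external {a} a∈A az = (inj₂ az , unique) , ∈∉⇒≢ a∈A z∉A ∘ sym
      where
      unique : ∀ a′ → a′ ∈ A → z ∈N[ a′ ] → a′ ≡ a
      unique a′ a′∈A (inj₁ z≡a′) = ⊥-elim (z∉A (subst (_∈ A) (sym z≡a′) a′∈A))
      unique a′ a′∈A (inj₂ a′z)  = sameNeighbour a∈A a′∈A az a′z

  module StuckWalk (A B : Subset n) (A-md : MinDom G A) (B-ind : Independent B) (B-md : MinDom G B)
                   (notAbsorbable : ∀ {b} → b ∈ B → b ∉ A → ¬ Dominating G (absorb A b))
                   (notRemovable : ∀ {a} → a ∈ A → a ∉ B → ¬ Removable A B a) where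

    -- The walk runs through B ∖ A, A ∖ B, outside A ∪ B, B ∖ A, …; every two steps change
    -- membership in A or in B, so it never backtracks.
    data Arc (x y : Fin n) : Set where
      toA   : x ∈ B → y ∈ A → y ∉ B → ∃ (ExternalPrivate A y) → Arc x y
      toOut : x ∉ B → ExternalPrivate A x y → y ∉ B → Arc x y
      toB   : x ∉ A → y ∈ B → y ∉ A → Arc x y

    absorbFails : ∀ {b} → b ∈ B → b ∉ A → ∃ λ a → Adj G b a × a ∈ A × a ∉ B × ∃ (ExternalPrivate A a)
    absorbFails b∈B b∉A =
      let _ , undominated = ¬∀⟶∃¬ n _ (dominatedBy? (absorb A _)) (notAbsorbable b∈B b∉A)
      in absorb-undominated (proj₁ A-md) B-ind b∈B b∉A undominated

    extend : ∀ {x y} → Adj G x y × Arc x y → ∃ λ z → z ≢ x × Adj G y z × Arc y z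
    extend (_ , toA x∈B y∈A y∉B y-has) =
      let y′ , y′-ext , y′∉B = nonRemovable (notRemovable y∈A y∉B) y-has
      in y′ , ∈∉⇒≢ x∈B y′∉B ∘ sym , externalPrivate-adj y′-ext , toOut y∉B y′-ext y′∉B
    extend {y = y} (_ , toOut x∉B y-ext y∉B) with proj₁ B-md y
    ... | inj₁ y∈B = ⊥-elim (y∉B y∈B)
    ... | inj₂ (b , b∈B , by) = b , ∈∉⇒≢ b∈B x∉B , Adj-sym by , toB (externalPrivate-∉ y-ext) b∈B b∉A
      where
      b∉A : b ∉ A
      b∉A b∈A = x∉B (subst (_∈ B) (proj₂ (proj₁ y-ext) b b∈A (inj₂ by)) b∈B)
    extend (_ , toB x∉A y∈B y∉A) =
      let a , ya , a∈A , a∉B , a-has = absorbFails y∈B y∉A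
      in a , ∈∉⇒≢ a∈A x∉A , ya , toA y∈B a∈A a∉B a-has

    impossible : ∀ {b} → b ∈ B → b ∉ A → ⊥
    impossible b∈B b∉A =
      let a , ba , a∈A , a∉B , a-has = absorbFails b∈B b∉A
      in noExtendableArcs (λ x y → Adj G x y × Arc x y) proj₁ extend (ba , toA b∈B a∈A a∉B a-has)

  decreasingStep : ∀ {A B b₀} → Independent A → MinDom G A → Independent B → MinDom G B →
                   b₀ ∈ B → b₀ ∉ A → ∃ λ X → Independent X × REdge G A X × X ∖ B ⊂ A ∖ B
  decreasingStep {A} {B} A-ind A-md B-ind B-md b₀∈B b₀∉A
    with any? (λ b → ∈-∖? B A b ×-dec dominating? (absorb A b))
  ... | yes (b , (b∈B , b∉A) , X-dom) =
    absorb A b , X-ind , (A-md , independent⇒minimal X-ind X-dom , inj₁ (absorb-swap b∉A)) ,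
    absorb-∖⊂ (proj₁ A-md) B-ind b∈B b∉A
    where
    X-ind : Independent (absorb A b)
    X-ind = absorb-independent A-ind
  ... | no noAbsorb with any? (λ a → ∈-∖? A B a ×-dec removable? A B a)
  ...   | yes (a , (a∈A , a∉B) , (y , y-ext) , allInB) =
    exchange A a , X-ind , (A-md , independent⇒minimal X-ind X-dom , inj₂ (exchange-swap a∈A)) ,
    ∖-⊂ keptFromA a∈A a∉B (∉-exchange A a)
    where
    X-ind : Independent (exchange A a)
    X-ind = exchange-independent A-ind
    X-dom : Dominating G (exchange A a)
    X-dom = exchange-dominating (proj₁ A-md)
              (inj₂ (y , ∈-select⁺ (exchanged? A a) (inj₂ y-ext) , Adj-sym (externalPrivate-adj y-ext)))
    keptFromA : ∀ {x} → x ∈ exchange A a → x ∉ B → x ∈ A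
    keptFromA x∈X x∉B with ∈-select⁻ (exchanged? A a) x∈X
    ... | inj₁ (x∈A , _) = x∈A
    ... | inj₂ x-ext     = ⊥-elim (x∉B (allInB _ x-ext))
  ...   | no noRemove = ⊥-elim (StuckWalk.impossible A B A-md B-ind B-md
                          (λ b∈B b∉A X-dom → noAbsorb (_ , (b∈B , b∉A) , X-dom))
                          (λ a∈A a∉B removable → noRemove (_ , (a∈A , a∉B) , removable))
                          b₀∈B b₀∉A)

  connectIndependent : ∀ A B → Acc _<_ ∣ A ∖ B ∣ → Independent A → MinDom G A →
                       Independent B → MinDom G B → Star (REdge G) A B
  connectIndependent A B (acc smaller) A-ind A-md B-ind B-md with any? (∈-∖? B A)
  ... | no none = subst (Star (REdge G) A) (sym (⊆-minimal⇒≡ A-md (proj₁ B-md) (∄∖⇒⊆ none))) ε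
  ... | yes (_ , b₀∈B , b₀∉A) =
    let X , X-ind , A—X , shrinks = decreasingStep A-ind A-md B-ind B-md b₀∈B b₀∉A
    in A—X ◅ connectIndependent X B (smaller (p⊂q⇒∣p∣<∣q∣ shrinks)) X-ind (proj₁ (proj₂ A—X)) B-ind B-md

theorem11 : ∀ (n : ℕ) (G : Graph n) → IsForest G → RConnected G
theorem11 n G forest M₁ M₂ md₁ md₂ =
  let I₁ , I₁-ind , I₁-md , M₁⋯I₁ = reachIndependent M₁ (<-wellFounded _) md₁
      I₂ , I₂-ind , I₂-md , M₂⋯I₂ = reachIndependent M₂ (<-wellFounded _) md₂
  in M₁⋯I₁ ◅◅ connectIndependent I₁ I₂ (<-wellFounded _) I₁-ind I₁-md I₂-ind I₂-md ◅◅
     reverse REdge-sym M₂⋯I₂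
  where
  open Domination G
  open ToIndependent G forest
  open BetweenIndependent G forest
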